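{- Let $G=(V,E)$ be a strongly connected directed multigraph with vertices $s,t\in V$, such that $G$ contains at least one arc $(t,s)$. Let $f$ be a flow from $s$ to $t$ in $G$ that does not use any arc $(t,s)$. If there is a path from $s$ to $t$ in the residual graph $G_f$, then $G_f$ is strongly connected.
   Context: A flow from $s$ to $t$ in an uncapacitated directed graph is a set of arc-disjoint paths from $s$ to $t$. The residual graph $G_f$ is obtained from $G$ by reversing each arc along each path of $f$. -}

module Defs where

open import Data.Nat using (ℕ)
open import Data.Fin using (Fin)
open import Data.Fin.Properties using () renaming (_≟_ to _≟ᶠ_)
open import Data.Bool using (Bool; if_then_else_)
open import Data.List using (List; []; _∷_; concatMap)
open import Data.List.Relation.Unary.Unique.Propositional using (Unique)
open import Data.List.Membership.Propositional using (_∈_; _∉_)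
open import Data.Product using (Σ; ∃; _×_)
open import Relation.Nullary.Decidable using (does)
open import Relation.Binary.PropositionalEquality using (_≡_)
import Data.List.Membership.DecPropositional as DecMem

record Graph : Set where
  field
    n    : ℕ
    m    : ℕ
    tail : Fin m → Fin n
    head : Fin m → Fin n
open Graph public

Vtx : Graph → Set
Vtx G = Fin (n G)

Arc : Graph → Set
Arc G = Fin (m G)

data Walk (G : Graph) : Vtx G → Vtx G → Set where
  nil  : ∀ {u} → Walk G u u
  cons : ∀ {u v} (e : Arc G) → tail G e ≡ u → Walk G (head G e) v → Walk G u v

arcsOf : ∀ {G u v} → Walk G u v → List (Arc G)
arcsOf nil          = []
arcsOf (cons e _ w) = e ∷ arcsOf w

vertsOf : ∀ {G u v} → Walk G u v → List (Vtx G)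
vertsOf {u = u} nil          = u ∷ []
vertsOf {u = u} (cons e _ w) = u ∷ vertsOf w

record Path (G : Graph) (u v : Vtx G) : Set where
  constructor path
  field
    walk   : Walk G u v
    simple : Unique (vertsOf walk)
open Path public

Reach : (G : Graph) → Vtx G → Vtx G → Set
Reach G u v = Walk G u v

StronglyConnected : Graph → Set
StronglyConnected G = ∀ (u v : Vtx G) → Walk G u v

record Flow (G : Graph) (s t : Vtx G) : Set where
  constructor flow
  field
    paths    : List (Path G s t)
    disjoint : Unique (concatMap (λ p → arcsOf (walk p)) paths)
open Flow public

flowArcs : ∀ {G s t} → Flow G s t → List (Arc G)
flowArcs f = concatMap (λ p → arcsOf (walk p)) (paths f)

usesArc : ∀ {G s t} → Flow G s t → Arc G → Bool
usesArc {G} f e = does (e ∈? flowArcs f)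
  where open DecMem (_≟ᶠ_ {m G})

residual : (G : Graph) {s t : Vtx G} → Flow G s t → Graph
residual G f = record
  { n    = n G
  ; m    = m G
  ; tail = λ e → if usesArc f e then head G e else tail G e
  ; head = λ e → if usesArc f e then tail G e else head G e
  }

{-# OPTIONS --safe #-}
-- An arc e of G that f does not use is still an arc of G_f.  If f uses e, then e
-- lies on some flow path p, and the arcs of p are reversed in G_f: walk backwards
-- along p from tail e to s, take the given s–t path of G_f, and walk backwards
-- along p from t to head e.  So every arc of G is bypassed by a walk of G_f, and
-- strong connectivity transfers from G to G_f.
module Submission where

open import Defs
open import Data.Bool using (if_then_else_)
open import Data.Product using (∃; ∃₂; _×_; _,_)
open import Data.List using (_∷_)
open import Data.List.Membership.Propositional using (_∈_; _∉_; find)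
open import Data.List.Membership.Propositional.Properties
  using (∈-concatMap⁻; ∈-concat⁺′; ∈-map⁺)
open import Data.List.Relation.Binary.Subset.Propositional using (_⊆_)
open import Data.List.Relation.Binary.Subset.Propositional.Properties
  using (∷⁺ʳ; xs⊆x∷xs)
open import Data.List.Relation.Unary.Any using (here; there)
open import Data.Fin.Properties using () renaming (_≟_ to _≟ᶠ_)
open import Function using (_∘_)
open import Relation.Nullary using (yes; no)
open import Relation.Nullary.Decidable using (dec-true; dec-false)
open import Relation.Binary.PropositionalEquality using (_≡_; refl)
import Data.List.Membership.DecPropositional as DecMembership

infixr 5 _++ʷ_

_++ʷ_ : ∀ {G u v w} → Walk G u v → Walk G v w → Walk G u w
nil        ++ʷ q = q
cons e p w ++ʷ q = cons e p (w ++ʷ q)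

splitAt : ∀ {G x y e} (w : Walk G x y) → e ∈ arcsOf w →
          ∃₂ λ (w₁ : Walk G x (tail G e)) (w₂ : Walk G (head G e) y) →
            arcsOf w₁ ⊆ arcsOf w × arcsOf w₂ ⊆ arcsOf w
splitAt (cons e refl w) (here refl) = nil , w , (λ ()) , xs⊆x∷xs _ e
splitAt (cons a refl w) (there e∈w) with splitAt w e∈w
... | w₁ , w₂ , w₁⊆w , w₂⊆w = cons a refl w₁ , w₂ , ∷⁺ʳ a w₁⊆w , there ∘ w₂⊆w

module _ {G : Graph} {s t : Vtx G} (f : Flow G s t) where

  open DecMembership (_≟ᶠ_ {m G}) using (_∈?_)

  Gf : Graph
  Gf = residual G f

  residualArc : ∀ {e b} → usesArc f e ≡ b →
                Walk Gf (if b then head G e else tail G e) (if b then tail G e else head G e)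
  residualArc {e} refl = cons e refl nil

  unused⇒forward : ∀ {e} → e ∉ flowArcs f → Walk Gf (tail G e) (head G e)
  unused⇒forward {e} e∉f = residualArc (dec-false (e ∈? flowArcs f) e∉f)

  used⇒reversed : ∀ {e} → e ∈ flowArcs f → Walk Gf (head G e) (tail G e)
  used⇒reversed {e} e∈f = residualArc (dec-true (e ∈? flowArcs f) e∈f)

  reverseUsed : ∀ {x y} (w : Walk G x y) → arcsOf w ⊆ flowArcs f → Walk Gf y x
  reverseUsed nil             _     = nil
  reverseUsed (cons e refl w) e∷w⊆f =
    reverseUsed w (e∷w⊆f ∘ there) ++ʷ used⇒reversed (e∷w⊆f (here refl))

  onFlowPath : ∀ {e} → e ∈ flowArcs f →
               ∃ λ p → e ∈ arcsOf (walk p) × arcsOf (walk p) ⊆ flowArcs f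
  onFlowPath e∈f with find (∈-concatMap⁻ (arcsOf ∘ walk) {paths f} e∈f)
  ... | p , p∈f , e∈p = p , e∈p , λ a∈p → ∈-concat⁺′ a∈p (∈-map⁺ (arcsOf ∘ walk) p∈f)

  module _ (P : Walk Gf s t) where

    usedArcBypass : ∀ {e} → e ∈ flowArcs f → Walk Gf (tail G e) (head G e)
    usedArcBypass e∈f with onFlowPath e∈f
    ... | p , e∈p , p⊆f with splitAt (walk p) e∈p
    ... | w₁ , w₂ , w₁⊆p , w₂⊆p =
      reverseUsed w₁ (p⊆f ∘ w₁⊆p) ++ʷ P ++ʷ reverseUsed w₂ (p⊆f ∘ w₂⊆p)

    arcBypass : ∀ e → Walk Gf (tail G e) (head G e)
    arcBypass e with e ∈? flowArcs f
    ... | yes e∈f = usedArcBypass e∈f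
    ... | no  e∉f = unused⇒forward e∉f

    walkBypass : ∀ {u v} → Walk G u v → Walk Gf u v
    walkBypass nil             = nil
    walkBypass (cons e refl w) = arcBypass e ++ʷ walkBypass w

lemma1p3 : (G : Graph) (s t : Vtx G) →
           StronglyConnected G →
           (∃ λ (a : Arc G) → tail G a ≡ t × head G a ≡ s) →
           (f : Flow G s t) →
           (∀ (a : Arc G) → tail G a ≡ t → head G a ≡ s → a ∉ flowArcs f) →
           Path (residual G f) s t →
           StronglyConnected (residual G f)
lemma1p3 G s t G-strong _ f _ P u v = walkBypass f (walk P) (G-strong u v)
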